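{- Let $\mathcal{G}$ be a finite partial Sherk plane in which some line is incident only with thick points. Let $v$ be the number of points of $\mathcal{G}$, let $n$ be the (constant) number of points on each line and $r$ the (constant) number of lines through each point. Then every line of $\mathcal{G}$ has exactly $(n^2-v)/(r-1)$ poles.
   Context: A partial Sherk plane is a structure of points, lines, an incidence relation, and a binary relation $\perp$ on lines satisfying: (A*) two distinct points lie on at most one line; (B1) $\ell\perp m$ implies $m\perp\ell$; (B2) perpendicular lines intersect in at least one point; (B3) for any point $P$ and line $\ell$ there is at least one line through $P$ perpendicular to $\ell$; (B4) for any line $\ell$ and point $P$ on $\ell$ there is a unique line through $P$ perpendicular to $\ell$; (B5) there exist lines $x,y,z$ with $x\perp y$, $x\not\perp z$, $y\not\perp z$, and $x,y,z$ not all through a common point. Finite means finitely many points. A point is thick if it lies on at least three lines. Under the hypotheses, all lines have the same number $n$ of points and all points lie on the same number $r$ of lines. A point $P$ not on a line $\ell$ is a pole of $\ell$ if more than one line through $P$ is perpendicular to $\ell$. -}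

module Defs where

open import Data.Nat using (ℕ; zero; suc; _≤_)
open import Data.Bool using (Bool; true; false; if_then_else_; _∧_; not; T)
open import Data.Fin using (Fin; zero; suc)
open import Data.Product using (Σ; ∃; ∃-syntax; _×_; _,_)
open import Relation.Nullary using (¬_)
open import Relation.Binary.PropositionalEquality using (_≡_; _≢_)

count : ∀ {k} → (Fin k → Bool) → ℕ
count {zero}  p = 0
count {suc k} p = (if p zero then 1 else 0) Data.Nat.+ count (λ i → p (suc i))

-- Incidence and perpendicularity are given as Boolean-valued relations
-- (hence decidable, as they are for any finite structure classically).
record PartialSherkPlane (v b : ℕ) : Set where
  field
    inc  : Fin v → Fin b → Bool
    perp : Fin b → Fin b → Bool

  On : Fin v → Fin b → Set
  On P ℓ = T (inc P ℓ)

  Perp : Fin b → Fin b → Set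
  Perp ℓ m = T (perp ℓ m)

  field
    axA  : ∀ P Q ℓ m → P ≢ Q → On P ℓ → On Q ℓ → On P m → On Q m → ℓ ≡ m
    axB1 : ∀ ℓ m → Perp ℓ m → Perp m ℓ
    axB2 : ∀ ℓ m → Perp ℓ m → ∃[ P ] (On P ℓ × On P m)
    axB3 : ∀ P ℓ → ∃[ m ] (On P m × Perp m ℓ)
    axB4 : ∀ ℓ P → On P ℓ →
           ∃[ m ] (On P m × Perp m ℓ × (∀ m' → On P m' → Perp m' ℓ → m' ≡ m))
    axB5 : ∃[ x ] ∃[ y ] ∃[ z ]
             (Perp x y × ¬ Perp x z × ¬ Perp y z ×
              ¬ (∃[ P ] (On P x × On P y × On P z)))

  #linesThrough : Fin v → ℕ
  #linesThrough P = count (λ m → inc P m)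

  #pointsOn : Fin b → ℕ
  #pointsOn ℓ = count (λ P → inc P ℓ)

  Thick : Fin v → Set
  Thick P = 3 ≤ #linesThrough P

  #perpsThrough : Fin v → Fin b → ℕ
  #perpsThrough P ℓ = count (λ m → inc P m ∧ perp m ℓ)

  isPole : Fin v → Fin b → Bool
  isPole P ℓ = not (inc P ℓ) ∧ (Data.Nat._≤ᵇ_ 2 (#perpsThrough P ℓ))

  #poles : Fin b → ℕ
  #poles ℓ = count (λ P → isPole P ℓ)

-- Fix a line ℓ and write t(X) for the number of lines through the point X
-- that are perpendicular to ℓ.  The proof is a double count of the flags
-- (X , m) with X on m and m ⊥ ℓ, restricted to points X of a chosen set S:
--     Σ_{X ∈ S} t(X)  =  Σ_{m ⊥ ℓ} |S ∩ m|.                  (perp-flags)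
-- If ℓ is not self-perpendicular, this identity yields, in turn,
--   * with S = ℓ: ℓ has exactly n perpendiculars (each point of ℓ lies on
--     one of them, each of them meets ℓ once);
--   * with S = a line k through a point X with t(X) ≥ 2: every line through
--     X is perpendicular to ℓ, so t(X) = r for every pole X and t(X) = 1
--     for every other point;
--   * with S = all points: v + (#poles)(r - 1) = n · n.
-- If ℓ ⊥ ℓ, then ℓ contains every point, so v = n ≤ 1 and ℓ has no poles.
module Submission where

open import Defs
open import Data.Nat using (ℕ; zero; suc; _+_; _*_; _∸_; _≤_; _<_; z≤n; s≤s)
open import Data.Nat.Properties
  using (≤-refl; ≤-reflexive; ≤-trans; ≤-antisym; ≤-pred; ≰⇒>; <-irrefl; ≤ᵇ⇒≤; ≤⇒≤ᵇ;
         +-comm; +-mono-≤; +-mono-<-≤; +-mono-≤-<; m≤n+m; m+[n∸m]≡n; +-*-semiring;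
         module ≤-Reasoning)
open import Data.Bool using (Bool; true; false; if_then_else_; _∧_; not; T)
open import Data.Bool.Properties using (∧-assoc; ∧-comm; T-∧; T-≡)
open import Data.Fin using (Fin; zero; suc; _≟_)
open import Data.Fin.Properties using (0≢1+n; suc-injective)
open import Data.Product using (∃-syntax; _,_; proj₁; proj₂)
open import Data.Empty using (⊥-elim)
open import Data.Unit using (tt)
open import Function using (_∘_; Equivalence)
open import Relation.Nullary using (¬_; yes; no)
open import Relation.Nullary.Decidable using (T?; decidable-stable)
open import Relation.Binary.PropositionalEquality
  using (_≡_; _≢_; refl; sym; trans; cong; cong₂; subst; module ≡-Reasoning)
open import Algebra.Properties.Semiring.Sum +-*-semiring
  using (sum; sum-cong-≗; ∑-comm; ∑-distrib-+)

open Equivalence using (to; from)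

T-not-∧ : ∀ a {c} → T (not a ∧ c) → ¬ T a
T-not-∧ true  () _
T-not-∧ false _  ()

¬T⇒T-not : ∀ a → ¬ T a → T (not a)
¬T⇒T-not true  ¬a = ¬a tt
¬T⇒T-not false _  = tt

if-cong : ∀ {x y} b → (T b → x ≡ y) → (if b then x else 0) ≡ (if b then y else 0)
if-cong true  x≡y = x≡y tt
if-cong false _   = refl

if-mono : ∀ {x y} b → (T b → x ≤ y) → (if b then x else 0) ≤ (if b then y else 0)
if-mono true  x≤y = x≤y tt
if-mono false _   = z≤n

if-mono-strict : ∀ {x y} b → T b → x < y → (if b then x else 0) < (if b then y else 0)
if-mono-strict true _ x<y = x<y

≤1⇒idempotent : ∀ {k} → k ≤ 1 → k ≡ k * k
≤1⇒idempotent {zero}        _ = refl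
≤1⇒idempotent {suc zero}    _ = refl
≤1⇒idempotent {suc (suc k)} (s≤s ())

sum-mono : ∀ {k} {f g : Fin k → ℕ} → (∀ i → f i ≤ g i) → sum f ≤ sum g
sum-mono {zero}  _   = z≤n
sum-mono {suc k} f≤g = +-mono-≤ (f≤g zero) (sum-mono (f≤g ∘ suc))

sum-mono-strict : ∀ {k} {f g : Fin k → ℕ} → (∀ i → f i ≤ g i) →
                  ∀ x → f x < g x → sum f < sum g
sum-mono-strict {suc k} f≤g zero    fx<gx = +-mono-<-≤ fx<gx (sum-mono (f≤g ∘ suc))
sum-mono-strict {suc k} f≤g (suc x) fx<gx = +-mono-≤-< (f≤g zero) (sum-mono-strict (f≤g ∘ suc) x fx<gx)

count≡sum : ∀ {k} (p : Fin k → Bool) → count p ≡ sum (λ i → if p i then 1 else 0)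
count≡sum {zero}  p = refl
count≡sum {suc k} p = cong ((if p zero then 1 else 0) +_) (count≡sum (p ∘ suc))

sum-if : ∀ {k} (p : Fin k → Bool) (c : ℕ) → sum (λ i → if p i then c else 0) ≡ count p * c
sum-if {zero}  p c = refl
sum-if {suc k} p c with p zero
... | true  = cong (c +_) (sum-if (p ∘ suc) c)
... | false = sum-if (p ∘ suc) c

count-cong : ∀ {k} {p q : Fin k → Bool} → (∀ i → p i ≡ q i) → count p ≡ count q
count-cong {k} {p} {q} p≡q = begin
  count p                           ≡⟨ count≡sum p ⟩
  sum (λ i → if p i then 1 else 0)  ≡⟨ sum-cong-≗ (λ i → cong (λ b → if b then 1 else 0) (p≡q i)) ⟩
  sum (λ i → if q i then 1 else 0)  ≡⟨ count≡sum q ⟨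
  count q                           ∎
  where open ≡-Reasoning

count-mono : ∀ {k} {p q : Fin k → Bool} → (∀ i → T (p i) → T (q i)) → count p ≤ count q
count-mono {zero}          _   = z≤n
count-mono {suc k} {p} {q} p⇒q = +-mono-≤ (first (p zero) (q zero) (p⇒q zero)) (count-mono (p⇒q ∘ suc))
  where
  first : ∀ a b → (T a → T b) → (if a then 1 else 0) ≤ (if b then 1 else 0)
  first true  true  _   = ≤-refl
  first true  false a⇒b = ⊥-elim (a⇒b tt)
  first false _     _   = z≤n

count-none : ∀ {k} (p : Fin k → Bool) → (∀ i → ¬ T (p i)) → count p ≡ 0
count-none {zero}  p none = refl
count-none {suc k} p none with p zero | none zero
... | false | _  = count-none (p ∘ suc) (none ∘ suc)
... | true  | ¬t = ⊥-elim (¬t tt)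

count-all : ∀ {k} (p : Fin k → Bool) → (∀ i → T (p i)) → count p ≡ k
count-all {zero}  p all = refl
count-all {suc k} p all with p zero | all zero
... | true | _ = cong suc (count-all (p ∘ suc) (all ∘ suc))

count-pos : ∀ {k} (p : Fin k → Bool) i → T (p i) → 1 ≤ count p
count-pos p zero    pi with p zero
... | true = s≤s z≤n
count-pos p (suc i) pi = ≤-trans (count-pos (p ∘ suc) i pi) (m≤n+m _ _)

count≤1 : ∀ {k} (p : Fin k → Bool) → (∀ i j → T (p i) → T (p j) → i ≡ j) → count p ≤ 1
count≤1 {zero}  p unique = z≤n
count≤1 {suc k} p unique with p zero in p0
... | true  = ≤-reflexive (cong suc (count-none (p ∘ suc) λ i pi →
                0≢1+n (unique zero (suc i) (from T-≡ p0) pi)))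
... | false = count≤1 (p ∘ suc) (λ i j pi pj → suc-injective (unique (suc i) (suc j) pi pj))

count-∧ : ∀ {k} b (q : Fin k → Bool) → count (λ i → b ∧ q i) ≡ (if b then count q else 0)
count-∧ true  q = refl
count-∧ {k} false q = count-none {k} (λ _ → false) (λ _ ())

double-count : ∀ {a c} (R : Fin a → Fin c → Bool) →
               sum (λ i → count (R i)) ≡ sum (λ j → count (λ i → R i j))
double-count R = begin
  sum (λ i → count (R i))                           ≡⟨ sum-cong-≗ (λ i → count≡sum (R i)) ⟩
  sum (λ i → sum (λ j → if R i j then 1 else 0))    ≡⟨ ∑-comm (λ i j → if R i j then 1 else 0) ⟩
  sum (λ j → sum (λ i → if R i j then 1 else 0))    ≡⟨ sum-cong-≗ (λ j → count≡sum (λ i → R i j)) ⟨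
  sum (λ j → count (λ i → R i j))                   ∎
  where open ≡-Reasoning

module Geometry {v b : ℕ} (G : PartialSherkPlane v b) where
  open PartialSherkPlane G

  #perps : Fin b → ℕ
  #perps ℓ = count (λ m → perp m ℓ)

  meet≤1 : ∀ k m → k ≢ m → count (λ X → inc X k ∧ inc X m) ≤ 1
  meet≤1 k m k≢m = count≤1 _ λ X Y XY XY' →
    let (Xk , Xm) = to T-∧ XY ; (Yk , Ym) = to T-∧ XY'
    in decidable-stable (X ≟ Y) (λ X≢Y → k≢m (axA X Y k m X≢Y Xk Yk Xm Ym))

  another-line : ∀ ℓ → ∃[ m ] m ≢ ℓ
  another-line ℓ with axB5
  ... | (x , y , z , x⊥y , x⊥̸z , _) with y ≟ ℓ
  ...   | yes refl = z , λ { refl → x⊥̸z x⊥y }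
  ...   | no  y≢ℓ  = y , y≢ℓ

  perpsThrough≥1 : ∀ X ℓ → 1 ≤ #perpsThrough X ℓ
  perpsThrough≥1 X ℓ =
    let (m , Xm , m⊥ℓ) = axB3 X ℓ in count-pos _ m (from T-∧ (Xm , m⊥ℓ))

  perpsThrough-on : ∀ X ℓ → On X ℓ → #perpsThrough X ℓ ≡ 1
  perpsThrough-on X ℓ Xℓ = ≤-antisym at-most-one (perpsThrough≥1 X ℓ)
    where
    at-most-one : #perpsThrough X ℓ ≤ 1
    at-most-one = count≤1 _ λ m m' Xm⊥ Xm'⊥ →
      let (_ , _ , _ , unique) = axB4 ℓ X Xℓ
          (Xm , m⊥ℓ) = to T-∧ Xm⊥ ; (Xm' , m'⊥ℓ) = to T-∧ Xm'⊥
      in trans (unique m Xm m⊥ℓ) (sym (unique m' Xm' m'⊥ℓ))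

  perp-flags : ∀ ℓ (S : Fin v → Bool) →
    sum (λ X → if S X then #perpsThrough X ℓ else 0) ≡
    sum (λ m → if perp m ℓ then count (λ X → S X ∧ inc X m) else 0)
  perp-flags ℓ S = begin
    sum (λ X → if S X then #perpsThrough X ℓ else 0)
      ≡⟨ sum-cong-≗ (λ X → count-∧ (S X) (λ m → inc X m ∧ perp m ℓ)) ⟨
    sum (λ X → count (λ m → flag X m))
      ≡⟨ double-count flag ⟩
    sum (λ m → count (λ X → flag X m))
      ≡⟨ sum-cong-≗ (λ m → count-cong (λ X → reorder (S X) (inc X m) (perp m ℓ))) ⟩
    sum (λ m → count (λ X → perp m ℓ ∧ (S X ∧ inc X m)))
      ≡⟨ sum-cong-≗ (λ m → count-∧ (perp m ℓ) (λ X → S X ∧ inc X m)) ⟩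
    sum (λ m → if perp m ℓ then count (λ X → S X ∧ inc X m) else 0) ∎
    where
    open ≡-Reasoning
    flag : Fin v → Fin b → Bool
    flag X m = S X ∧ (inc X m ∧ perp m ℓ)
    reorder : ∀ a c d → a ∧ (c ∧ d) ≡ d ∧ (a ∧ c)
    reorder a c d = trans (sym (∧-assoc a c d)) (∧-comm (a ∧ c) d)

  -- A self-perpendicular line contains every point: the perpendicular m
  -- through X meets ℓ in a point Q, where (B4) forces m = ℓ.
  self-perp-covers : ∀ ℓ → Perp ℓ ℓ → ∀ X → On X ℓ
  self-perp-covers ℓ ℓ⊥ℓ X =
    let (m , Xm , m⊥ℓ) = axB3 X ℓ
        (Q , Qm , Qℓ)  = axB2 m ℓ m⊥ℓ
        (_ , _ , _ , unique) = axB4 ℓ Q Qℓ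
    in subst (On X) (trans (unique m Qm m⊥ℓ) (sym (unique ℓ Qℓ ℓ⊥ℓ))) Xm

  perp-meets-once : ∀ ℓ m → ¬ Perp ℓ ℓ → Perp m ℓ → count (λ X → inc X ℓ ∧ inc X m) ≡ 1
  perp-meets-once ℓ m ℓ⊥̸ℓ m⊥ℓ =
    let (P , Pm , Pℓ) = axB2 m ℓ m⊥ℓ
    in ≤-antisym (meet≤1 ℓ m ℓ≢m) (count-pos _ P (from T-∧ (Pℓ , Pm)))
    where
    ℓ≢m : ℓ ≢ m
    ℓ≢m refl = ℓ⊥̸ℓ m⊥ℓ

  module Regular (n r : ℕ) (hn : ∀ ℓ → #pointsOn ℓ ≡ n) (hr : ∀ P → #linesThrough P ≡ r) where

    -- A self-perpendicular line is the whole plane: v = n, and n ≤ 1 since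
    -- another line shares at most one point with ℓ; there are no poles.
    poles-self-perp : ∀ ℓ → Perp ℓ ℓ → #poles ℓ * (r ∸ 1) + v ≡ n * n
    poles-self-perp ℓ ℓ⊥ℓ =
      trans (cong (λ p → p * (r ∸ 1) + v) no-poles) (trans v≡n (≤1⇒idempotent n≤1))
      where
      covers : ∀ X → On X ℓ
      covers = self-perp-covers ℓ ℓ⊥ℓ
      no-poles : #poles ℓ ≡ 0
      no-poles = count-none _ (λ X pole → T-not-∧ (inc X ℓ) pole (covers X))
      v≡n : v ≡ n
      v≡n = trans (sym (count-all _ covers)) (hn ℓ)
      n≤1 : n ≤ 1
      n≤1 with another-line ℓ
      ... | m , m≢ℓ = begin
        n                                ≡⟨ hn m ⟨
        #pointsOn m                      ≤⟨ count-mono (λ X Xm → from T-∧ (covers X , Xm)) ⟩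
        count (λ X → inc X ℓ ∧ inc X m)  ≤⟨ meet≤1 ℓ m (m≢ℓ ∘ sym) ⟩
        1                                ∎
        where open ≤-Reasoning

    module NonSelfPerpendicular (ℓ : Fin b) (ℓ⊥̸ℓ : ¬ Perp ℓ ℓ) where

      #perps≡n : #perps ℓ ≡ n
      #perps≡n = begin
        #perps ℓ
          ≡⟨ count≡sum (λ m → perp m ℓ) ⟩
        sum (λ m → if perp m ℓ then 1 else 0)
          ≡⟨ sum-cong-≗ (λ m → if-cong (perp m ℓ) (sym ∘ perp-meets-once ℓ m ℓ⊥̸ℓ)) ⟩
        sum (λ m → if perp m ℓ then count (λ X → inc X ℓ ∧ inc X m) else 0)
          ≡⟨ perp-flags ℓ (λ X → inc X ℓ) ⟨
        sum (λ X → if inc X ℓ then #perpsThrough X ℓ else 0)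
          ≡⟨ sum-cong-≗ (λ X → if-cong (inc X ℓ) (perpsThrough-on X ℓ)) ⟩
        sum (λ X → if inc X ℓ then 1 else 0)
          ≡⟨ count≡sum (λ X → inc X ℓ) ⟨
        #pointsOn ℓ
          ≡⟨ hn ℓ ⟩
        n ∎
        where open ≡-Reasoning

      -- Otherwise the points of k carry
      -- more than n flags while the n perpendiculars meet k at most once each.
      many-perps⇒all-perp : ∀ X k → 2 ≤ #perpsThrough X ℓ → On X k → Perp k ℓ
      many-perps⇒all-perp X k many Xk = decidable-stable (T? (perp k ℓ)) λ k⊥̸ℓ →
        <-irrefl refl (begin-strict
          n
            ≡⟨ hn k ⟨
          #pointsOn k
            ≡⟨ count≡sum (λ Y → inc Y k) ⟩
          sum (λ Y → if inc Y k then 1 else 0)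
            <⟨ sum-mono-strict (λ Y → if-mono (inc Y k) (λ _ → perpsThrough≥1 Y ℓ))
                               X (if-mono-strict (inc X k) Xk many) ⟩
          sum (λ Y → if inc Y k then #perpsThrough Y ℓ else 0)
            ≡⟨ perp-flags ℓ (λ Y → inc Y k) ⟩
          sum (λ m → if perp m ℓ then count (λ Y → inc Y k ∧ inc Y m) else 0)
            ≤⟨ sum-mono (λ m → if-mono (perp m ℓ) (λ m⊥ℓ → meet≤1 k m λ { refl → k⊥̸ℓ m⊥ℓ })) ⟩
          sum (λ m → if perp m ℓ then 1 else 0)
            ≡⟨ count≡sum (λ m → perp m ℓ) ⟨
          #perps ℓ
            ≡⟨ #perps≡n ⟩
          n ∎)
        where open ≤-Reasoning

      pole-perps : ∀ X → T (isPole X ℓ) → #perpsThrough X ℓ ≡ r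
      pole-perps X pole = trans (≤-antisym perps≤lines lines≤perps) (hr X)
        where
        all-perp : ∀ m → On X m → Perp m ℓ
        all-perp m = many-perps⇒all-perp X m (≤ᵇ⇒≤ 2 _ (proj₂ (to T-∧ pole)))
        perps≤lines : #perpsThrough X ℓ ≤ #linesThrough X
        perps≤lines = count-mono (λ m Xm⊥ → proj₁ (to (T-∧ {inc X m}) Xm⊥))
        lines≤perps : #linesThrough X ≤ #perpsThrough X ℓ
        lines≤perps = count-mono (λ m Xm → from T-∧ (Xm , all-perp m Xm))

      non-pole-perps : ∀ X → ¬ T (isPole X ℓ) → #perpsThrough X ℓ ≡ 1
      non-pole-perps X ¬pole with T? (inc X ℓ)
      ... | yes Xℓ = perpsThrough-on X ℓ Xℓ
      ... | no ¬Xℓ = ≤-antisym (≤-pred (≰⇒> few)) (perpsThrough≥1 X ℓ)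
        where
        few : ¬ 2 ≤ #perpsThrough X ℓ
        few many = ¬pole (from T-∧ (¬T⇒T-not (inc X ℓ) ¬Xℓ , ≤⇒≤ᵇ many))

      perpsThrough-count : ∀ X → #perpsThrough X ℓ ≡ 1 + (if isPole X ℓ then r ∸ 1 else 0)
      perpsThrough-count X with isPole X ℓ in pole
      ... | true  = trans t≡r (sym (m+[n∸m]≡n (subst (1 ≤_) t≡r (perpsThrough≥1 X ℓ))))
        where
        t≡r : #perpsThrough X ℓ ≡ r
        t≡r = pole-perps X (from T-≡ pole)
      ... | false = non-pole-perps X (λ p → subst T pole p)

      poles-non-self-perp : #poles ℓ * (r ∸ 1) + v ≡ n * n
      poles-non-self-perp = begin
        #poles ℓ * (r ∸ 1) + v
          ≡⟨ +-comm _ v ⟩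
        v + #poles ℓ * (r ∸ 1)
          ≡⟨ cong₂ _+_ #points (sum-if (λ X → isPole X ℓ) (r ∸ 1)) ⟨
        sum (λ (X : Fin v) → 1) + sum (λ X → if isPole X ℓ then r ∸ 1 else 0)
          ≡⟨ ∑-distrib-+ (λ (X : Fin v) → 1) (λ X → if isPole X ℓ then r ∸ 1 else 0) ⟨
        sum (λ X → 1 + (if isPole X ℓ then r ∸ 1 else 0))
          ≡⟨ sum-cong-≗ perpsThrough-count ⟨
        sum (λ X → #perpsThrough X ℓ)
          ≡⟨ perp-flags ℓ (λ X → true) ⟩
        sum (λ m → if perp m ℓ then #pointsOn m else 0)
          ≡⟨ sum-cong-≗ (λ m → cong (λ k → if perp m ℓ then k else 0) (hn m)) ⟩
        sum (λ m → if perp m ℓ then n else 0)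
          ≡⟨ sum-if (λ m → perp m ℓ) n ⟩
        #perps ℓ * n
          ≡⟨ cong (_* n) #perps≡n ⟩
        n * n ∎
        where
        open ≡-Reasoning
        #points : sum (λ (X : Fin v) → 1) ≡ v
        #points = trans (sym (count≡sum (λ (X : Fin v) → true))) (count-all _ (λ X → tt))

    poles-formula : ∀ ℓ → #poles ℓ * (r ∸ 1) + v ≡ n * n
    poles-formula ℓ with T? (perp ℓ ℓ)
    ... | yes ℓ⊥ℓ = poles-self-perp ℓ ℓ⊥ℓ
    ... | no  ℓ⊥̸ℓ = NonSelfPerpendicular.poles-non-self-perp ℓ ℓ⊥̸ℓ

lemma3p17 : (v b n r : ℕ) (G : PartialSherkPlane v b) →
    let open PartialSherkPlane G in
    (∀ ℓ → #pointsOn ℓ ≡ n) →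
    (∀ P → #linesThrough P ≡ r) →
    (∃[ ℓ ] (∀ P → On P ℓ → Thick P)) →
    ∀ ℓ → #poles ℓ * (r ∸ 1) + v ≡ n * n
lemma3p17 v b n r G points-per-line lines-per-point _ =
  Geometry.Regular.poles-formula G n r points-per-line lines-per-point
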